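{- Let $\alpha$ be a simplex of a vertex triangulation of a simplotope $\Pi(c_1,\dots,c_n)$ (with $N=c_1+\cdots+c_n$). Then the class of $\alpha$, defined as $|\det[\mathbf 1\mid M_{\mathbf v}]|$ where $M_{\mathbf v}$ is the $(N+1)\times N$ matrix whose rows are the reduced coordinates with respect to a vertex $\mathbf v$ of the simplotope of the vertices of $\alpha$ and $\mathbf 1$ is a column of ones, does not depend on the choice of the vertex $\mathbf v$.
   Context: $\Delta^d$ is the convex hull of the standard unit vectors of $\mathbb{R}^{d+1}$ and $\Pi(c_1,\dots,c_n)=\Delta^{c_1}\times\cdots\times\Delta^{c_n}$, written in standard coordinates $(\mathbf x^1;\dots;\mathbf x^n)$ with $\mathbf x^i=(x^i_1,\dots,x^i_{c_i+1})\in\Delta^{c_i}$. Its vertices are the points with all coordinates in $\{0,1\}$. For a vertex $\mathbf v$, the reduced coordinates of a point with respect to $\mathbf v$ are obtained from its standard coordinates by deleting, in each factor $i$, the unique coordinate $x^i_j$ at which $\mathbf v$ equals $1$; this gives a vector in $\mathbb{R}^N$. A vertex triangulation of a polytope is a triangulation (decomposition into simplices meeting face-to-face) all of whose vertices are vertices of the polytope. -}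

module Defs where

open import Data.Nat as ℕ using (ℕ; zero; suc)
open import Data.Fin using (Fin; zero; suc; splitAt; _↑ˡ_; _↑ʳ_; punchIn; _≟_)
open import Data.Sum using ([_,_]′)
open import Data.List using (List; []; _∷_)
open import Data.Product using (Σ; ∃; _×_; _,_)
open import Data.Unit using (⊤)
open import Data.Bool using (if_then_else_)
open import Relation.Nullary using (does)
open import Data.Integer as ℤ using (ℤ; ∣_∣; -_)
open import Data.Rational as ℚ using (ℚ; 0ℚ; 1ℚ)
open import Relation.Binary.PropositionalEquality using (_≡_)
open import Function using (_∘_)

-- Simplotope Π(c₁,…,cₙ) given by the list cs = c₁ ∷ … ∷ cₙ ∷ [].

-- A vertex: in each factor i, the index j ∈ {0..cᵢ} of the coordinate equal to 1.
Vtx : List ℕ → Set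
Vtx []       = ⊤
Vtx (c ∷ cs) = Fin (suc c) × Vtx cs

dimN : List ℕ → ℕ
dimN []       = 0
dimN (c ∷ cs) = c ℕ.+ dimN cs

ambD : List ℕ → ℕ
ambD []       = 0
ambD (c ∷ cs) = suc c ℕ.+ ambD cs

δ : ∀ {m} {A : Set} → A → A → Fin m → Fin m → A
δ one zer a b = if does (a ≟ b) then one else zer

stdCoord : ∀ {A : Set} → A → A → (cs : List ℕ) → Vtx cs → Fin (ambD cs) → A
stdCoord one zer []       _       ()
stdCoord one zer (c ∷ cs) (a , v) k =
  [ (λ j → δ one zer a j) , stdCoord one zer cs v ]′ (splitAt (suc c) k)

-- reduced coordinates w.r.t. vertex v: delete in each factor i the
-- coordinate at which v equals 1 (remaining coordinates in increasing order)
reduce : ∀ {A : Set} (cs : List ℕ) → Vtx cs → (Fin (ambD cs) → A) → Fin (dimN cs) → A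
reduce []       _       x ()
reduce (c ∷ cs) (a , v) x k =
  [ (λ j → x (punchIn a j ↑ˡ ambD cs)) , reduce cs v (x ∘ (suc c ↑ʳ_)) ]′ (splitAt c k)

sumFin : ∀ {A : Set} → (A → A → A) → A → (m : ℕ) → (Fin m → A) → A
sumFin _+_ z zero    f = z
sumFin _+_ z (suc m) f = f zero + sumFin _+_ z m (f ∘ suc)

sumℤ : (m : ℕ) → (Fin m → ℤ) → ℤ
sumℤ = sumFin ℤ._+_ ℤ.0ℤ

sumℚ : (m : ℕ) → (Fin m → ℚ) → ℚ
sumℚ = sumFin ℚ._+_ 0ℚ

altSign : ℕ → ℤ
altSign zero    = ℤ.1ℤ
altSign (suc n) = - altSign n

det : (m : ℕ) → (Fin m → Fin m → ℤ) → ℤ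
det zero    M = ℤ.1ℤ
det (suc m) M = sumℤ (suc m) (λ j →
  altSign (Data.Fin.toℕ j) ℤ.* M zero j ℤ.* det m (λ r c → M (suc r) (punchIn j c)))

oneBar : ∀ {m} → (Fin m → ℤ) → Fin (suc m) → ℤ
oneBar row zero    = ℤ.1ℤ
oneBar row (suc k) = row k

classOf : (cs : List ℕ) → Vtx cs → (Fin (suc (dimN cs)) → Vtx cs) → ℕ
classOf cs v α =
  ∣ det (suc (dimN cs)) (λ r → oneBar (reduce cs v (stdCoord ℤ.1ℤ ℤ.0ℤ cs (α r)))) ∣

-- geometry over ℚ (all polytopes involved are rational)

Point : List ℕ → Set
Point cs = Fin (ambD cs) → ℚ

stdℚ : (cs : List ℕ) → Vtx cs → Point cs
stdℚ = stdCoord 1ℚ 0ℚ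

InΠ : (cs : List ℕ) → Point cs → Set
InΠ []       p = ⊤
InΠ (c ∷ cs) p =
  ((∀ j → 0ℚ ℚ.≤ p (j ↑ˡ ambD cs)) × sumℚ (suc c) (p ∘ (_↑ˡ ambD cs)) ≡ 1ℚ)
  × InΠ cs (p ∘ (suc c ↑ʳ_))

InConv : (cs : List ℕ) {m : ℕ} → (Fin m → Vtx cs) → Point cs → Set
InConv cs {m} f p = Σ (Fin m → ℚ) λ t →
  (∀ k → 0ℚ ℚ.≤ t k) × (sumℚ m t ≡ 1ℚ)
  × (∀ d → p d ≡ sumℚ m (λ k → t k ℚ.* stdℚ cs (f k) d))

InConvSet : (cs : List ℕ) → (Vtx cs → Set) → Point cs → Set
InConvSet cs P p = Σ ℕ λ m → Σ (Fin m → Vtx cs) λ f → (∀ k → P (f k)) × InConv cs f p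

AffIndep : (cs : List ℕ) {m : ℕ} → (Fin m → Vtx cs) → Set
AffIndep cs {m} f = ∀ (t : Fin m → ℚ) → sumℚ m t ≡ 0ℚ →
  (∀ d → sumℚ m (λ k → t k ℚ.* stdℚ cs (f k) d) ≡ 0ℚ) → ∀ k → t k ≡ 0ℚ

IsVertexOf : (cs : List ℕ) {m : ℕ} → (Fin m → Vtx cs) → Vtx cs → Set
IsVertexOf cs f w = ∃ λ k → f k ≡ w

record VertexTriangulation (cs : List ℕ) : Set where
  field
    numSimplices : ℕ
    simplex      : Fin numSimplices → Fin (suc (dimN cs)) → Vtx cs
    affIndep     : ∀ s → AffIndep cs (simplex s)
    covers       : ∀ p → InΠ cs p → ∃ λ s → InConv cs (simplex s) p
    faceToFace   : ∀ s t p → InConv cs (simplex s) p → InConv cs (simplex t) p →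
                   InConvSet cs (λ w → IsVertexOf cs (simplex s) w × IsVertexOf cs (simplex t) w) p

-- Call two vertices of Π(c₁,…,cₙ) adjacent (a Step) if they differ in
-- one factor only, where the coordinate 1 moves from position j to j + 1.
-- Along such a step the reduced coordinates change in a single position p of
-- that factor: the new coordinate x_j is 1 minus the sum of the old
-- coordinates of the factor (whose standard coordinates sum to 1).  Hence the
-- matrix [1 | M_w] arises from [1 | M_v] by replacing column p with
-- (ones) − Σ (columns of the factor), and by column operations its
-- determinant only changes sign.  Every vertex is reached from the origin by
-- steps, so |det [1 | M_v]| is the same for all v.  Nothing about the
-- triangulation is used: the statement holds for any N + 1 vertices.

module Submission where

open import Defs
open import Data.Nat as ℕ using (ℕ; zero; suc)
import Data.Nat.Properties as ℕ
open import Data.Fin using (Fin; zero; suc; punchIn; punchOut; inject₁; toℕ; _≟_; _↑ˡ_; _↑ʳ_; splitAt)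
open import Data.Fin.Properties
  using (punchIn-injective; punchInᵢ≢i; punchIn-punchOut; toℕ-injective; toℕ-inject₁; suc-injective;
         splitAt-↑ˡ; splitAt-↑ʳ; splitAt⁻¹-↑ˡ; splitAt⁻¹-↑ʳ; ↑ˡ-injective; ↑ʳ-injective)
open import Data.Integer using (ℤ; -_; _+_; _*_; 0ℤ; 1ℤ; -1ℤ; ∣_∣)
open import Data.Integer.Properties using (+-identityˡ; +-identityʳ; *-identityˡ; *-identityʳ; *-zeroʳ; -1*i≡-i; neg-distrib-+; neg-involutive; ∣-i∣≡∣i∣)
open import Data.Integer.Tactic.RingSolver using (solve-∀)
open import Data.List using (List; []; _∷_)
open import Data.Product using (Σ; _×_; _,_; proj₂)
open import Data.Sum using (_⊎_; inj₁; inj₂)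
open import Data.Bool using (true; false; if_then_else_)
open import Data.Empty using (⊥-elim)
open import Relation.Nullary using (does; yes; no)
open import Relation.Nullary.Decidable using (dec-true; dec-false)
open import Relation.Binary using (tri<; tri≈; tri>)
open import Relation.Binary.PropositionalEquality
open import Relation.Binary.Construct.Closure.ReflexiveTransitive using (Star; ε; _◅_; _◅◅_; gmap; fold)
open import Function using (_∘_; id)
open import Data.Unit using (tt)
open ≡-Reasoning

sumℤ-cong : ∀ m {f g : Fin m → ℤ} → (∀ i → f i ≡ g i) → sumℤ m f ≡ sumℤ m g
sumℤ-cong zero    f≗g = refl
sumℤ-cong (suc m) f≗g = cong₂ _+_ (f≗g zero) (sumℤ-cong m (f≗g ∘ suc))

sumℤ-zero : ∀ m (f : Fin m → ℤ) → (∀ i → f i ≡ 0ℤ) → sumℤ m f ≡ 0ℤ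
sumℤ-zero zero    f f≗0 = refl
sumℤ-zero (suc m) f f≗0 = cong₂ _+_ (f≗0 zero) (sumℤ-zero m (f ∘ suc) (f≗0 ∘ suc))

sumℤ-linear : ∀ m (x y : ℤ) (f g : Fin m → ℤ) →
  sumℤ m (λ i → x * f i + y * g i) ≡ x * sumℤ m f + y * sumℤ m g
sumℤ-linear zero    x y f g = regroup x y
  where
  regroup : ∀ x y → 0ℤ ≡ x * 0ℤ + y * 0ℤ
  regroup = solve-∀
sumℤ-linear (suc m) x y f g = begin
  (x * f zero + y * g zero) + sumℤ m (λ i → x * f (suc i) + y * g (suc i))
    ≡⟨ cong (x * f zero + y * g zero +_) (sumℤ-linear m x y (f ∘ suc) (g ∘ suc)) ⟩
  (x * f zero + y * g zero) + (x * sumℤ m (f ∘ suc) + y * sumℤ m (g ∘ suc))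
    ≡⟨ regroup x y (f zero) (g zero) (sumℤ m (f ∘ suc)) (sumℤ m (g ∘ suc)) ⟩
  x * sumℤ (suc m) f + y * sumℤ (suc m) g ∎
  where
  regroup : ∀ x y a b S T → (x * a + y * b) + (x * S + y * T) ≡ x * (a + S) + y * (b + T)
  regroup = solve-∀

sumℤ-remove : ∀ c (f : Fin (suc c) → ℤ) (a : Fin (suc c)) →
  sumℤ (suc c) f ≡ f a + sumℤ c (f ∘ punchIn a)
sumℤ-remove c       f zero    = refl
sumℤ-remove (suc c) f (suc a) = begin
  f zero + sumℤ (suc c) (f ∘ suc)
    ≡⟨ cong (f zero +_) (sumℤ-remove c (f ∘ suc) a) ⟩
  f zero + (f (suc a) + sumℤ c (f ∘ suc ∘ punchIn a))
    ≡⟨ swap-front (f zero) (f (suc a)) _ ⟩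
  f (suc a) + (f zero + sumℤ c (f ∘ suc ∘ punchIn a)) ∎
  where
  swap-front : ∀ x y S → x + (y + S) ≡ y + (x + S)
  swap-front = solve-∀

sumℤ-adjacentPair : ∀ n (f : Fin (suc n) → ℤ) (i : Fin n) →
  (∀ k → k ≢ inject₁ i → k ≢ suc i → f k ≡ 0ℤ) → f (inject₁ i) + f (suc i) ≡ 0ℤ →
  sumℤ (suc n) f ≡ 0ℤ
sumℤ-adjacentPair (suc n) f zero others pair = begin
  f zero + (f (suc zero) + sumℤ n (λ k → f (suc (suc k))))
    ≡⟨ cong (λ S → f zero + (f (suc zero) + S)) (sumℤ-zero n _ λ k → others (suc (suc k)) (λ ()) (λ ())) ⟩
  f zero + (f (suc zero) + 0ℤ)   ≡⟨ drop-zero (f zero) (f (suc zero)) ⟩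
  f zero + f (suc zero)          ≡⟨ pair ⟩
  0ℤ ∎
  where
  drop-zero : ∀ a b → a + (b + 0ℤ) ≡ a + b
  drop-zero = solve-∀
sumℤ-adjacentPair (suc n) f (suc i) others pair =
  cong₂ _+_ (others zero (λ ()) (λ ()))
            (sumℤ-adjacentPair n (f ∘ suc) i (λ k k≢i k≢i+1 → others (suc k) (k≢i ∘ suc-injective) (k≢i+1 ∘ suc-injective)) pair)

does-sym : ∀ {n} (i j : Fin n) → does (i ≟ j) ≡ does (j ≟ i)
does-sym i j with i ≟ j
... | yes refl = sym (dec-true (i ≟ i) refl)
... | no  i≢j  = sym (dec-false (j ≟ i) (i≢j ∘ sym))

does-injective : ∀ {a b} (f : Fin a → Fin b) → (∀ i j → f i ≡ f j → i ≡ j) →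
  ∀ i j → does (f i ≟ f j) ≡ does (i ≟ j)
does-injective f f-inj i j with i ≟ j
... | yes refl = dec-true (f i ≟ f i) refl
... | no  i≢j  = dec-false (f i ≟ f j) (i≢j ∘ f-inj i j)

sumℤ-single : ∀ c (j : Fin c) x → sumℤ c (λ i → if does (i ≟ j) then x else 0ℤ) ≡ x
sumℤ-single (suc c) zero    x = trans (cong (x +_) (sumℤ-zero c _ λ _ → refl)) (+-identityʳ x)
sumℤ-single (suc c) (suc j) x = trans (+-identityˡ _) (sumℤ-single c j x)

sumℤ-negate : ∀ t (f : Fin t → ℤ) → sumℤ t (λ i → -1ℤ * f i) ≡ - sumℤ t f
sumℤ-negate zero    f = refl
sumℤ-negate (suc t) f = begin
  -1ℤ * f zero + sumℤ t (λ i → -1ℤ * f (suc i)) ≡⟨ cong₂ _+_ (-1*i≡-i (f zero)) (sumℤ-negate t (f ∘ suc)) ⟩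
  - f zero + - sumℤ t (f ∘ suc)                  ≡⟨ neg-distrib-+ (f zero) (sumℤ t (f ∘ suc)) ⟨
  - sumℤ (suc t) f ∎

Matrix : ℕ → Set
Matrix m = Fin m → Fin m → ℤ

minor : ∀ {m} → Fin (suc m) → Matrix (suc m) → Matrix m
minor k A r c = A (suc r) (punchIn k c)

laplaceTerm : ∀ {m} → Matrix (suc m) → Fin (suc m) → ℤ
laplaceTerm {m} A k = altSign (toℕ k) * A zero k * det m (minor k A)

AgreeOff : ∀ {m} → Fin m → Matrix m → Matrix m → Set
AgreeOff p A B = ∀ r c → c ≢ p → A r c ≡ B r c

det-cong : ∀ m {A B : Matrix m} → (∀ r c → A r c ≡ B r c) → det m A ≡ det m B
det-cong zero    A≗B = refl
det-cong (suc m) A≗B = sumℤ-cong (suc m) λ k →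
  cong₂ (λ a d → altSign (toℕ k) * a * d) (A≗B zero k) (det-cong m λ r c → A≗B (suc r) (punchIn k c))

det-minor-agree : ∀ {m} {p : Fin (suc m)} {A C : Matrix (suc m)} →
  AgreeOff p A C → det m (minor p A) ≡ det m (minor p C)
det-minor-agree {m} {p} A≈C = det-cong m λ r c → A≈C (suc r) (punchIn p c) (punchInᵢ≢i p c)

minor-agreeOff : ∀ {m} {k p : Fin (suc m)} {A C : Matrix (suc m)} (k≢p : k ≢ p) →
  AgreeOff p A C → AgreeOff (punchOut k≢p) (minor k A) (minor k C)
minor-agreeOff {k = k} k≢p A≈C r c c≢p′ = A≈C (suc r) (punchIn k c) λ eq →
  c≢p′ (punchIn-injective k c _ (trans eq (sym (punchIn-punchOut k≢p))))

minor-column : ∀ {m} {k p : Fin (suc m)} (A : Matrix (suc m)) (k≢p : k ≢ p) r →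
  minor k A r (punchOut k≢p) ≡ A (suc r) p
minor-column A k≢p r = cong (A (suc r)) (punchIn-punchOut k≢p)

det-linear : ∀ m (A B C : Matrix m) (p : Fin m) (x y : ℤ) →
  AgreeOff p A C → AgreeOff p B C → (∀ r → C r p ≡ x * A r p + y * B r p) →
  det m C ≡ x * det m A + y * det m B
det-linear zero    A B C () x y _ _ _
det-linear (suc m) A B C p x y A≈C B≈C colC = begin
  sumℤ (suc m) (laplaceTerm C)
    ≡⟨ sumℤ-cong (suc m) termwise ⟩
  sumℤ (suc m) (λ k → x * laplaceTerm A k + y * laplaceTerm B k)
    ≡⟨ sumℤ-linear (suc m) x y (laplaceTerm A) (laplaceTerm B) ⟩
  x * det (suc m) A + y * det (suc m) B ∎
  where
  termwise : ∀ k → laplaceTerm C k ≡ x * laplaceTerm A k + y * laplaceTerm B k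
  termwise k with k ≟ p
  ... | yes refl = begin
    s * C zero k * det m (minor k C)
      ≡⟨ cong (λ e → s * e * det m (minor k C)) (colC zero) ⟩
    s * (x * A zero k + y * B zero k) * det m (minor k C)
      ≡⟨ distribute x y s (A zero k) (B zero k) (det m (minor k C)) ⟩
    x * (s * A zero k * det m (minor k C)) + y * (s * B zero k * det m (minor k C))
      ≡⟨ cong₂ (λ dA dB → x * (s * A zero k * dA) + y * (s * B zero k * dB))
               (sym (det-minor-agree A≈C)) (sym (det-minor-agree B≈C)) ⟩
    x * laplaceTerm A k + y * laplaceTerm B k ∎
    where
    s = altSign (toℕ k)
    distribute : ∀ x y s a b d → s * (x * a + y * b) * d ≡ x * (s * a * d) + y * (s * b * d)
    distribute = solve-∀
  ... | no k≢p = begin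
    s * C zero k * det m (minor k C)
      ≡⟨ cong (s * C zero k *_) (det-linear m (minor k A) (minor k B) (minor k C) p′ x y
                                   (minor-agreeOff k≢p A≈C) (minor-agreeOff k≢p B≈C) minorColC) ⟩
    s * C zero k * (x * det m (minor k A) + y * det m (minor k B))
      ≡⟨ distribute x y s (C zero k) (det m (minor k A)) (det m (minor k B)) ⟩
    x * (s * C zero k * det m (minor k A)) + y * (s * C zero k * det m (minor k B))
      ≡⟨ cong₂ (λ a b → x * (s * a * det m (minor k A)) + y * (s * b * det m (minor k B)))
               (sym (A≈C zero k k≢p)) (sym (B≈C zero k k≢p)) ⟩
    x * laplaceTerm A k + y * laplaceTerm B k ∎
    where
    s = altSign (toℕ k)
    p′ = punchOut k≢p
    minorColC : ∀ r → minor k C r p′ ≡ x * minor k A r p′ + y * minor k B r p′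
    minorColC r = begin
      minor k C r p′                    ≡⟨ minor-column C k≢p r ⟩
      C (suc r) p                       ≡⟨ colC (suc r) ⟩
      x * A (suc r) p + y * B (suc r) p ≡⟨ cong₂ (λ a b → x * a + y * b) (minor-column A k≢p r) (minor-column B k≢p r) ⟨
      x * minor k A r p′ + y * minor k B r p′ ∎
    distribute : ∀ x y s c dA dB → s * c * (x * dA + y * dB) ≡ x * (s * c * dA) + y * (s * c * dB)
    distribute = solve-∀

punchIn-keepsAdjacent : ∀ {m} (k : Fin (suc (suc m))) (i : Fin (suc m)) → k ≢ inject₁ i → k ≢ suc i →
  Σ (Fin m) λ i′ → punchIn k (inject₁ i′) ≡ inject₁ i × punchIn k (suc i′) ≡ suc i
punchIn-keepsAdjacent zero          zero    k≢i k≢i+1 = ⊥-elim (k≢i refl)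
punchIn-keepsAdjacent zero          (suc i) k≢i k≢i+1 = i , refl , refl
punchIn-keepsAdjacent (suc zero)    zero    k≢i k≢i+1 = ⊥-elim (k≢i+1 refl)
punchIn-keepsAdjacent {suc m} (suc (suc k)) zero k≢i k≢i+1 = zero , refl , refl
punchIn-keepsAdjacent {suc m} (suc k) (suc i) k≢i k≢i+1
  with punchIn-keepsAdjacent k i (k≢i ∘ cong suc) (k≢i+1 ∘ cong suc)
... | i′ , e₁ , e₂ = suc i′ , cong suc e₁ , cong suc e₂

punchIn-adjacent-off : ∀ {n} (i c : Fin n) → c ≢ i → punchIn (inject₁ i) c ≡ punchIn (suc i) c
punchIn-adjacent-off zero    zero    c≢i = ⊥-elim (c≢i refl)
punchIn-adjacent-off zero    (suc c) c≢i = refl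
punchIn-adjacent-off (suc i) zero    c≢i = refl
punchIn-adjacent-off (suc i) (suc c) c≢i = cong suc (punchIn-adjacent-off i c (c≢i ∘ cong suc))

punchIn-adjacent-at : ∀ {n} (i : Fin n) → punchIn (inject₁ i) i ≡ suc i × punchIn (suc i) i ≡ inject₁ i
punchIn-adjacent-at zero    = refl , refl
punchIn-adjacent-at (suc i) with punchIn-adjacent-at i
... | e₁ , e₂ = cong suc e₁ , cong suc e₂

-- A matrix with two equal adjacent columns has determinant zero: the Laplace
-- terms for the two columns cancel, and every other minor has equal adjacent columns.
det-adjacentEqual : ∀ m (A : Matrix (suc m)) (i : Fin m) →
  (∀ r → A r (inject₁ i) ≡ A r (suc i)) → det (suc m) A ≡ 0ℤ
det-adjacentEqual (suc m) A i equal = sumℤ-adjacentPair (suc m) (laplaceTerm A) i others cancel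
  where
  others : ∀ k → k ≢ inject₁ i → k ≢ suc i → laplaceTerm A k ≡ 0ℤ
  others k k≢i k≢i+1 with punchIn-keepsAdjacent k i k≢i k≢i+1
  ... | i′ , e₁ , e₂ =
    trans (cong (altSign (toℕ k) * A zero k *_) (det-adjacentEqual m (minor k A) i′ minorEqual))
          (*-zeroʳ (altSign (toℕ k) * A zero k))
    where
    minorEqual : ∀ r → minor k A r (inject₁ i′) ≡ minor k A r (suc i′)
    minorEqual r = trans (cong (A (suc r)) e₁) (trans (equal (suc r)) (cong (A (suc r)) (sym e₂)))
  sameMinor : ∀ r c → minor (inject₁ i) A r c ≡ minor (suc i) A r c
  sameMinor r c with c ≟ i
  ... | no c≢i   = cong (A (suc r)) (punchIn-adjacent-off i c c≢i)
  ... | yes refl = let e₁ , e₂ = punchIn-adjacent-at c in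
    trans (cong (A (suc r)) e₁) (trans (sym (equal (suc r))) (cong (A (suc r)) (sym e₂)))
  opposite : ∀ s a d → s * a * d + (- s) * a * d ≡ 0ℤ
  opposite = solve-∀
  cancel : laplaceTerm A (inject₁ i) + laplaceTerm A (suc i) ≡ 0ℤ
  cancel rewrite toℕ-inject₁ i | equal zero | det-cong (suc m) sameMinor =
    opposite (altSign (toℕ i)) (A zero (suc i)) (det (suc m) (minor (suc i) A))

setColumn : ∀ {m} → Matrix m → Fin m → (Fin m → ℤ) → Matrix m
setColumn A p f r c = if does (c ≟ p) then f r else A r c

setColumn-at : ∀ {m} (A : Matrix m) p f r → setColumn A p f r p ≡ f r
setColumn-at A p f r rewrite dec-true (p ≟ p) refl = refl

setColumn-off : ∀ {m} (A : Matrix m) p f → AgreeOff p (setColumn A p f) A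
setColumn-off A p f r c c≢p rewrite dec-false (c ≟ p) c≢p = refl

setColumn-agreeOff : ∀ {m} {A B : Matrix m} {p} q f → AgreeOff p A B → AgreeOff p (setColumn A q f) (setColumn B q f)
setColumn-agreeOff q f A≈B r c c≢p with does (c ≟ q)
... | true  = refl
... | false = A≈B r c c≢p

det-additive : ∀ m (A B C : Matrix m) (p : Fin m) →
  AgreeOff p A C → AgreeOff p B C → (∀ r → C r p ≡ A r p + B r p) →
  det m C ≡ det m A + det m B
det-additive m A B C p A≈C B≈C colC =
  trans (det-linear m A B C p 1ℤ 1ℤ A≈C B≈C λ r → trans (colC r) (sym (unit-coefficients (A r p) (B r p))))
        (unit-coefficients (det m A) (det m B))
  where
  unit-coefficients : ∀ a b → 1ℤ * a + 1ℤ * b ≡ a + b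
  unit-coefficients = solve-∀

inject₁≢suc : ∀ {m} (i : Fin m) → inject₁ i ≢ suc i
inject₁≢suc zero    ()
inject₁≢suc (suc i) eq = inject₁≢suc i (suc-injective eq)

setAdjacent : ∀ {m} → Matrix (suc m) → Fin m → (Fin (suc m) → ℤ) → (Fin (suc m) → ℤ) → Matrix (suc m)
setAdjacent A i x y = setColumn (setColumn A (inject₁ i) x) (suc i) y

swapAdjacent : ∀ {m} → Matrix (suc m) → Fin m → Matrix (suc m)
swapAdjacent A i = setAdjacent A i (λ r → A r (suc i)) (λ r → A r (inject₁ i))

module _ {m} (A : Matrix (suc m)) (i : Fin m) where

  setAdjacent-first : ∀ x y r → setAdjacent A i x y r (inject₁ i) ≡ x r
  setAdjacent-first x y r =
    trans (setColumn-off (setColumn A (inject₁ i) x) (suc i) y r (inject₁ i) (inject₁≢suc i)) (setColumn-at A (inject₁ i) x r)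

  setAdjacent-second : ∀ x y r → setAdjacent A i x y r (suc i) ≡ y r
  setAdjacent-second x y r = setColumn-at (setColumn A (inject₁ i) x) (suc i) y r

  setAdjacent-others : ∀ x y r c → c ≢ inject₁ i → c ≢ suc i → setAdjacent A i x y r c ≡ A r c
  setAdjacent-others x y r c c≢i c≢i+1 =
    trans (setColumn-off (setColumn A (inject₁ i) x) (suc i) y r c c≢i+1) (setColumn-off A (inject₁ i) x r c c≢i)

  setAdjacent-varyFirst : ∀ x x′ y → AgreeOff (inject₁ i) (setAdjacent A i x y) (setAdjacent A i x′ y)
  setAdjacent-varyFirst x x′ y = setColumn-agreeOff (suc i) y λ r c c≢i →
    trans (setColumn-off A (inject₁ i) x r c c≢i) (sym (setColumn-off A (inject₁ i) x′ r c c≢i))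

  setAdjacent-varySecond : ∀ x y y′ → AgreeOff (suc i) (setAdjacent A i x y) (setAdjacent A i x y′)
  setAdjacent-varySecond x y y′ r c c≢i+1 =
    trans (setColumn-off (setColumn A (inject₁ i) x) (suc i) y r c c≢i+1)
          (sym (setColumn-off (setColumn A (inject₁ i) x) (suc i) y′ r c c≢i+1))

  -- With a, b the two
  -- columns and D x y = det (setAdjacent A i x y), expanding
  -- 0 = D (a+b) (a+b) by additivity gives 0 = D a a + D a b + D b a + D b b
  -- = det A + det (swapAdjacent A i).
  det-swapAdjacent : det (suc m) (swapAdjacent A i) ≡ - det (suc m) A
  det-swapAdjacent = solve-for (det (suc m) A) (det (suc m) (swapAdjacent A i)) expansion
    where
    a b a+b : Fin (suc m) → ℤ
    a r = A r (inject₁ i)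
    b r = A r (suc i)
    a+b r = a r + b r
    D : (Fin (suc m) → ℤ) → (Fin (suc m) → ℤ) → ℤ
    D x y = det (suc m) (setAdjacent A i x y)

    additiveFirst : ∀ x y z → (∀ r → z r ≡ x r + y r) → ∀ w → D z w ≡ D x w + D y w
    additiveFirst x y z z≡ w = det-additive (suc m) _ _ _ (inject₁ i)
      (setAdjacent-varyFirst x z w) (setAdjacent-varyFirst y z w)
      λ r → trans (setAdjacent-first z w r)
              (trans (z≡ r) (sym (cong₂ _+_ (setAdjacent-first x w r) (setAdjacent-first y w r))))

    additiveSecond : ∀ x y z → (∀ r → z r ≡ x r + y r) → ∀ w → D w z ≡ D w x + D w y
    additiveSecond x y z z≡ w = det-additive (suc m) _ _ _ (suc i)
      (setAdjacent-varySecond w x z) (setAdjacent-varySecond w y z)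
      λ r → trans (setAdjacent-second w z r)
              (trans (z≡ r) (sym (cong₂ _+_ (setAdjacent-second w x r) (setAdjacent-second w y r))))

    repeated : ∀ x → D x x ≡ 0ℤ
    repeated x = det-adjacentEqual m (setAdjacent A i x x) i λ r → trans (setAdjacent-first x x r) (sym (setAdjacent-second x x r))

    restore : ∀ r c → setAdjacent A i a b r c ≡ A r c
    restore r c with c ≟ suc i
    ... | yes refl = refl
    ... | no _ with c ≟ inject₁ i
    ...   | yes refl = refl
    ...   | no _     = refl

    expansion : (0ℤ + det (suc m) A) + (det (suc m) (swapAdjacent A i) + 0ℤ) ≡ 0ℤ
    expansion = begin
      (0ℤ + det (suc m) A) + (D b a + 0ℤ)
        ≡⟨ cong₂ (λ u v → (u + det (suc m) A) + (D b a + v)) (repeated a) (repeated b) ⟨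
      (D a a + det (suc m) A) + (D b a + D b b)
        ≡⟨ cong (λ d → (D a a + d) + (D b a + D b b)) (det-cong (suc m) restore) ⟨
      (D a a + D a b) + (D b a + D b b)
        ≡⟨ cong₂ _+_ (additiveSecond a b a+b (λ _ → refl) a) (additiveSecond a b a+b (λ _ → refl) b) ⟨
      D a a+b + D b a+b
        ≡⟨ additiveFirst a b a+b (λ _ → refl) a+b ⟨
      D a+b a+b
        ≡⟨ repeated a+b ⟩
      0ℤ ∎

    solve-for : ∀ d d′ → (0ℤ + d) + (d′ + 0ℤ) ≡ 0ℤ → d′ ≡ - d
    solve-for d d′ e = begin
      d′                              ≡⟨ rearrange d d′ ⟨
      ((0ℤ + d) + (d′ + 0ℤ)) + - d    ≡⟨ cong (_+ - d) e ⟩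
      0ℤ + - d                        ≡⟨ +-identityˡ (- d) ⟩
      - d ∎
      where
      rearrange : ∀ d d′ → ((0ℤ + d) + (d′ + 0ℤ)) + - d ≡ d′
      rearrange = solve-∀

-- Equal columns p and i+1 with toℕ i = toℕ p + d give determinant zero: by
-- induction on d, exchanging columns i and i+1 brings the copy of column p one
-- step closer while only changing the sign.
det-equalColumnsAtDistance : ∀ d m (A : Matrix (suc m)) (p : Fin (suc m)) (i : Fin m) →
  toℕ i ≡ toℕ p ℕ.+ d → (∀ r → A r p ≡ A r (suc i)) → det (suc m) A ≡ 0ℤ
det-equalColumnsAtDistance zero m A p i dist equal
  with toℕ-injective (trans (toℕ-inject₁ i) (trans dist (ℕ.+-identityʳ (toℕ p))))
... | refl = det-adjacentEqual m A i equal
det-equalColumnsAtDistance (suc d) m A p zero dist equal =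
  ⊥-elim (ℕ.0≢1+n (trans dist (ℕ.+-suc (toℕ p) d)))
det-equalColumnsAtDistance (suc d) (suc m) A p (suc j) dist equal = begin
  det (suc (suc m)) A                          ≡⟨ neg-involutive _ ⟨
  - - det (suc (suc m)) A                      ≡⟨ cong -_ (det-swapAdjacent A (suc j)) ⟨
  - det (suc (suc m)) (swapAdjacent A (suc j)) ≡⟨ cong -_ swappedVanishes ⟩
  0ℤ ∎
  where
  toℕi≡ : toℕ (suc j) ≡ suc (toℕ p ℕ.+ d)
  toℕi≡ = trans dist (ℕ.+-suc (toℕ p) d)
  p≢i : p ≢ inject₁ (suc j)
  p≢i eq = ℕ.m≢1+m+n (toℕ p) (trans (cong toℕ eq) (trans (toℕ-inject₁ (suc j)) toℕi≡))
  p≢i+1 : p ≢ suc (suc j)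
  p≢i+1 eq = ℕ.m≢1+m+n (toℕ p) (trans (cong toℕ eq) (cong suc dist))
  swappedVanishes : det (suc (suc m)) (swapAdjacent A (suc j)) ≡ 0ℤ
  swappedVanishes = det-equalColumnsAtDistance d (suc m) (swapAdjacent A (suc j)) p (inject₁ j)
    (trans (toℕ-inject₁ j) (ℕ.suc-injective toℕi≡))
    λ r → trans (setAdjacent-others A (suc j) b a r p p≢i p≢i+1)
                (trans (equal r) (sym (setAdjacent-first A (suc j) b a r)))
    where
    a b : Fin (suc (suc m)) → ℤ
    a r = A r (inject₁ (suc j))
    b r = A r (suc (suc j))

det-equalColumns< : ∀ m (A : Matrix (suc m)) (p q : Fin (suc m)) →
  toℕ p ℕ.< toℕ q → (∀ r → A r p ≡ A r q) → det (suc m) A ≡ 0ℤ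
det-equalColumns< m A p (suc i) (ℕ.s≤s p≤i) equal with ℕ.m≤n⇒∃[o]m+o≡n p≤i
... | d , p+d≡i = det-equalColumnsAtDistance d m A p i (sym p+d≡i) equal

det-equalColumns : ∀ m (A : Matrix (suc m)) (p q : Fin (suc m)) →
  p ≢ q → (∀ r → A r p ≡ A r q) → det (suc m) A ≡ 0ℤ
det-equalColumns m A p q p≢q equal with ℕ.<-cmp (toℕ p) (toℕ q)
... | tri< p<q _ _ = det-equalColumns< m A p q p<q equal
... | tri≈ _ p≡q _ = ⊥-elim (p≢q (toℕ-injective p≡q))
... | tri> _ _ q<p = det-equalColumns< m A q p q<p (sym ∘ equal)

setColumn-copy : ∀ {m} (A : Matrix m) {p q : Fin m} → q ≡ p → ∀ r c → setColumn A p (λ r → A r q) r c ≡ A r c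
setColumn-copy A {p} q≡p r c with c ≟ p
... | yes refl = cong (A r) q≡p
... | no _     = refl

weightOf : ∀ {m t} → (Fin t → ℤ) → (Fin t → Fin m) → Fin m → ℤ
weightOf {t = t} z q p = sumℤ t (λ i → if does (q i ≟ p) then z i else 0ℤ)

scale-indicator : ∀ b x → x * (if b then 1ℤ else 0ℤ) ≡ (if b then x else 0ℤ)
scale-indicator true  x = *-identityʳ x
scale-indicator false x = *-zeroʳ x

-- If column p of C is the combination Σᵢ zᵢ · (column qᵢ of A) and C agrees
-- with A elsewhere, then det C = (weight of column p) · det A: by linearity in
-- column p, the summand i contributes zᵢ · det A if qᵢ = p and otherwise the
-- determinant of a matrix with a repeated column, i.e. zero.
det-columnCombination : ∀ m (A C : Matrix (suc m)) (p : Fin (suc m))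
  (t : ℕ) (z : Fin t → ℤ) (q : Fin t → Fin (suc m)) →
  AgreeOff p A C → (∀ r → C r p ≡ sumℤ t (λ i → z i * A r (q i))) →
  det (suc m) C ≡ weightOf z q p * det (suc m) A
det-columnCombination m A C p zero z q A≈C colC =
  det-linear (suc m) A A C p 0ℤ 0ℤ A≈C A≈C λ r → colC r
det-columnCombination m A C p (suc t) z q A≈C colC = begin
  det (suc m) C
    ≡⟨ det-linear (suc m) E D C p (z zero) 1ℤ E≈C D≈C splitColumn ⟩
  z zero * det (suc m) E + 1ℤ * det (suc m) D
    ≡⟨ cong₂ (λ e d → z zero * e + 1ℤ * d) det-E det-D ⟩
  z zero * (indicator * det (suc m) A) + 1ℤ * (restWeight * det (suc m) A)
    ≡⟨ regroup (z zero) indicator restWeight (det (suc m) A) ⟩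
  (z zero * indicator + restWeight) * det (suc m) A
    ≡⟨ cong (λ c → (c + restWeight) * det (suc m) A) (scale-indicator (does (q zero ≟ p)) (z zero)) ⟩
  weightOf z q p * det (suc m) A ∎
  where
  first rest : Fin (suc m) → ℤ
  first r = A r (q zero)
  rest  r = sumℤ t (λ i → z (suc i) * A r (q (suc i)))
  E D : Matrix (suc m)
  E = setColumn A p first
  D = setColumn A p rest
  indicator restWeight : ℤ
  indicator  = if does (q zero ≟ p) then 1ℤ else 0ℤ
  restWeight = weightOf (z ∘ suc) (q ∘ suc) p

  E≈C : AgreeOff p E C
  E≈C r c c≢p = trans (setColumn-off A p first r c c≢p) (A≈C r c c≢p)
  D≈C : AgreeOff p D C
  D≈C r c c≢p = trans (setColumn-off A p rest r c c≢p) (A≈C r c c≢p)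

  splitColumn : ∀ r → C r p ≡ z zero * E r p + 1ℤ * D r p
  splitColumn r = begin
    C r p                              ≡⟨ colC r ⟩
    z zero * first r + rest r          ≡⟨ cong (z zero * first r +_) (*-identityˡ (rest r)) ⟨
    z zero * first r + 1ℤ * rest r     ≡⟨ cong₂ (λ e d → z zero * e + 1ℤ * d) (setColumn-at A p first r) (setColumn-at A p rest r) ⟨
    z zero * E r p + 1ℤ * D r p ∎

  det-E : det (suc m) E ≡ (if does (q zero ≟ p) then 1ℤ else 0ℤ) * det (suc m) A
  det-E with q zero ≟ p
  ... | yes q≡p = trans (det-cong (suc m) (setColumn-copy A q≡p)) (sym (*-identityˡ _))
  ... | no  q≢p = det-equalColumns m E p (q zero) (q≢p ∘ sym)
                    λ r → trans (setColumn-at A p first r) (sym (setColumn-off A p first r (q zero) q≢p))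

  det-D : det (suc m) D ≡ restWeight * det (suc m) A
  det-D = det-columnCombination m A D p t (z ∘ suc) (q ∘ suc)
            (λ r c c≢p → sym (setColumn-off A p rest r c c≢p)) (setColumn-at A p rest)

  regroup : ∀ x e w d → x * (e * d) + 1ℤ * (w * d) ≡ (x * e + w) * d
  regroup = solve-∀

red : (cs : List ℕ) → Vtx cs → Vtx cs → Fin (dimN cs) → ℤ
red cs v u = reduce cs v (stdCoord 1ℤ 0ℤ cs u)

classMatrix : (cs : List ℕ) → Vtx cs → (Fin (suc (dimN cs)) → Vtx cs) → Matrix (suc (dimN cs))
classMatrix cs v α r = oneBar (red cs v (α r))

blocks : ∀ c n (k : Fin (c ℕ.+ n)) → (Σ (Fin c) λ i → k ≡ i ↑ˡ n) ⊎ (Σ (Fin n) λ k′ → k ≡ c ↑ʳ k′)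
blocks c n k with splitAt c k in eq
... | inj₁ i  = inj₁ (i , sym (splitAt⁻¹-↑ˡ eq))
... | inj₂ k′ = inj₂ (k′ , sym (splitAt⁻¹-↑ʳ eq))

reduce-cong : ∀ cs (v : Vtx cs) {x y : Fin (ambD cs) → ℤ} → (∀ k → x k ≡ y k) →
  ∀ k → reduce cs v x k ≡ reduce cs v y k
reduce-cong []       v       x≗y ()
reduce-cong (c ∷ cs) (a , v) x≗y k with splitAt c k
... | inj₁ i  = x≗y _
... | inj₂ k′ = reduce-cong cs v (x≗y ∘ (suc c ↑ʳ_)) k′

red-head : ∀ c cs (a b : Fin (suc c)) (v u : Vtx cs) i →
  red (c ∷ cs) (a , v) (b , u) (i ↑ˡ dimN cs) ≡ δ 1ℤ 0ℤ b (punchIn a i)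
red-head c cs a b v u i rewrite splitAt-↑ˡ c i (dimN cs) | splitAt-↑ˡ (suc c) (punchIn a i) (ambD cs) = refl

red-tail : ∀ c cs (a b : Fin (suc c)) (v u : Vtx cs) k →
  red (c ∷ cs) (a , v) (b , u) (c ↑ʳ k) ≡ red cs v u k
red-tail c cs a b v u k rewrite splitAt-↑ʳ c (dimN cs) k = reduce-cong cs v stdCoord-tail k
  where
  stdCoord-tail : ∀ d → stdCoord 1ℤ 0ℤ (c ∷ cs) (b , u) (suc c ↑ʳ d) ≡ stdCoord 1ℤ 0ℤ cs u d
  stdCoord-tail d rewrite splitAt-↑ʳ (suc c) (ambD cs) d = refl

-- The standard coordinates of a vertex in one factor sum to 1, so the
-- coordinate at a is 1 minus the sum of the others.
vertexCoordinate : ∀ c (a b : Fin (suc c)) →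
  δ 1ℤ 0ℤ b a ≡ 1ℤ + - sumℤ c (λ i → δ 1ℤ 0ℤ b (punchIn a i))
vertexCoordinate c a b = begin
  δ 1ℤ 0ℤ b a                 ≡⟨ isolate (δ 1ℤ 0ℤ b a) others ⟩
  (δ 1ℤ 0ℤ b a + others) + - others ≡⟨ cong (_+ - others) (sumℤ-remove c (δ 1ℤ 0ℤ b) a) ⟨
  sumℤ (suc c) (δ 1ℤ 0ℤ b) + - others ≡⟨ cong (_+ - others) total ⟩
  1ℤ + - others ∎
  where
  others = sumℤ c (λ i → δ 1ℤ 0ℤ b (punchIn a i))
  isolate : ∀ x S → x ≡ (x + S) + - S
  isolate = solve-∀
  total : sumℤ (suc c) (δ 1ℤ 0ℤ b) ≡ 1ℤ
  total = trans (sumℤ-cong (suc c) λ i → cong (if_then 1ℤ else 0ℤ) (does-sym b i)) (sumℤ-single (suc c) b 1ℤ)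

data Step : (cs : List ℕ) → Vtx cs → Vtx cs → Set where
  here  : ∀ {c cs} (j : Fin c) (v : Vtx cs) → Step (c ∷ cs) (inject₁ j , v) (suc j , v)
  there : ∀ {c cs} (a : Fin (suc c)) {v w : Vtx cs} → Step cs v w → Step (c ∷ cs) (a , v) (a , w)

-- How reduced coordinates change from v to w along a step: they agree except
-- at one position pos, where the new coordinate is 1 minus the sum of the old
-- coordinates over a block of positions that contains pos exactly once
-- (so the weights −1 of the block entries equal to pos add up to −1).
record ReducedChange (cs : List ℕ) (v w : Vtx cs) : Set where
  field
    pos        : Fin (dimN cs)
    size       : ℕ
    block      : Fin size → Fin (dimN cs)
    pos-once   : weightOf (λ _ → -1ℤ) block pos ≡ -1ℤ
    unchanged  : ∀ u k → k ≢ pos → red cs w u k ≡ red cs v u k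
    changed    : ∀ u → red cs w u pos ≡ 1ℤ + - sumℤ size (λ i → red cs v u (block i))

here-change : ∀ {c cs} (j : Fin c) (v : Vtx cs) → ReducedChange (c ∷ cs) (inject₁ j , v) (suc j , v)
here-change {c} {cs} j v = record
  { pos       = j ↑ˡ n
  ; size      = c
  ; block     = _↑ˡ n
  ; pos-once  = trans (sumℤ-cong c λ i → cong (if_then -1ℤ else 0ℤ) (does-injective (_↑ˡ n) (↑ˡ-injective n) i j))
                      (sumℤ-single c j -1ℤ)
  ; unchanged = unchanged
  ; changed   = changed
  }
  where
  n = dimN cs
  unchanged : ∀ u k → k ≢ j ↑ˡ n → red (c ∷ cs) (suc j , v) u k ≡ red (c ∷ cs) (inject₁ j , v) u k
  unchanged (b , u) k k≢pos with blocks c n k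
  ... | inj₁ (i , refl) = begin
    red (c ∷ cs) (suc j , v) (b , u) (i ↑ˡ n)     ≡⟨ red-head c cs (suc j) b v u i ⟩
    δ 1ℤ 0ℤ b (punchIn (suc j) i)                  ≡⟨ cong (δ 1ℤ 0ℤ b) (punchIn-adjacent-off j i (k≢pos ∘ cong (_↑ˡ n))) ⟨
    δ 1ℤ 0ℤ b (punchIn (inject₁ j) i)              ≡⟨ red-head c cs (inject₁ j) b v u i ⟨
    red (c ∷ cs) (inject₁ j , v) (b , u) (i ↑ˡ n) ∎
  ... | inj₂ (k′ , refl) = trans (red-tail c cs (suc j) b v u k′) (sym (red-tail c cs (inject₁ j) b v u k′))
  changed : ∀ u → red (c ∷ cs) (suc j , v) u (j ↑ˡ n)
                  ≡ 1ℤ + - sumℤ c (λ i → red (c ∷ cs) (inject₁ j , v) u (i ↑ˡ n))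
  changed (b , u) = begin
    red (c ∷ cs) (suc j , v) (b , u) (j ↑ˡ n)           ≡⟨ red-head c cs (suc j) b v u j ⟩
    δ 1ℤ 0ℤ b (punchIn (suc j) j)                        ≡⟨ cong (δ 1ℤ 0ℤ b) (proj₂ (punchIn-adjacent-at j)) ⟩
    δ 1ℤ 0ℤ b (inject₁ j)                                ≡⟨ vertexCoordinate c (inject₁ j) b ⟩
    1ℤ + - sumℤ c (λ i → δ 1ℤ 0ℤ b (punchIn (inject₁ j) i))
      ≡⟨ cong (λ S → 1ℤ + - S) (sumℤ-cong c λ i → red-head c cs (inject₁ j) b v u i) ⟨
    1ℤ + - sumℤ c (λ i → red (c ∷ cs) (inject₁ j , v) (b , u) (i ↑ˡ n)) ∎

there-change : ∀ {c cs} (a : Fin (suc c)) {v w : Vtx cs} →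
  ReducedChange cs v w → ReducedChange (c ∷ cs) (a , v) (a , w)
there-change {c} {cs} a {v} {w} ch = record
  { pos       = c ↑ʳ pos
  ; size      = size
  ; block     = (c ↑ʳ_) ∘ block
  ; pos-once  = trans (sumℤ-cong size λ i → cong (if_then -1ℤ else 0ℤ)
                         (does-injective (c ↑ʳ_) (↑ʳ-injective c) (block i) pos))
                      pos-once
  ; unchanged = unchanged′
  ; changed   = changed′
  }
  where
  open ReducedChange ch
  unchanged′ : ∀ u k → k ≢ c ↑ʳ pos → red (c ∷ cs) (a , w) u k ≡ red (c ∷ cs) (a , v) u k
  unchanged′ (b , u) k k≢pos with blocks c (dimN cs) k
  ... | inj₁ (i , refl)  = trans (red-head c cs a b w u i) (sym (red-head c cs a b v u i))
  ... | inj₂ (k′ , refl) = begin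
    red (c ∷ cs) (a , w) (b , u) (c ↑ʳ k′) ≡⟨ red-tail c cs a b w u k′ ⟩
    red cs w u k′                          ≡⟨ unchanged u k′ (k≢pos ∘ cong (c ↑ʳ_)) ⟩
    red cs v u k′                          ≡⟨ red-tail c cs a b v u k′ ⟨
    red (c ∷ cs) (a , v) (b , u) (c ↑ʳ k′) ∎
  changed′ : ∀ u → red (c ∷ cs) (a , w) u (c ↑ʳ pos)
                   ≡ 1ℤ + - sumℤ size (λ i → red (c ∷ cs) (a , v) u (c ↑ʳ block i))
  changed′ (b , u) = begin
    red (c ∷ cs) (a , w) (b , u) (c ↑ʳ pos)              ≡⟨ red-tail c cs a b w u pos ⟩
    red cs w u pos                                       ≡⟨ changed u ⟩
    1ℤ + - sumℤ size (λ i → red cs v u (block i))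
      ≡⟨ cong (λ S → 1ℤ + - S) (sumℤ-cong size λ i → red-tail c cs a b v u (block i)) ⟨
    1ℤ + - sumℤ size (λ i → red (c ∷ cs) (a , v) (b , u) (c ↑ʳ block i)) ∎

step-change : ∀ {cs} {v w : Vtx cs} → Step cs v w → ReducedChange cs v w
step-change (here j v)   = here-change j v
step-change (there a st) = there-change a (step-change st)

-- Along a step v ⇝ w the matrix [1 | M_w] arises from [1 | M_v] by replacing
-- column pos by (column of ones) − Σ (block columns); its weight on column pos
-- is −1, so the determinant changes sign.
det-step : ∀ {cs} {v w : Vtx cs} → Step cs v w → ∀ α →
  det (suc (dimN cs)) (classMatrix cs w α) ≡ - det (suc (dimN cs)) (classMatrix cs v α)
det-step {cs} {v} {w} st α = begin
  det (suc n) (classMatrix cs w α)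
    ≡⟨ det-columnCombination n (classMatrix cs v α) (classMatrix cs w α) (suc pos) (suc size) z q
         agreeOff newColumn ⟩
  (0ℤ + weightOf (λ _ → -1ℤ) block pos) * det (suc n) (classMatrix cs v α)
    ≡⟨ cong (_* det (suc n) (classMatrix cs v α)) (trans (+-identityˡ _) pos-once) ⟩
  -1ℤ * det (suc n) (classMatrix cs v α)
    ≡⟨ -1*i≡-i _ ⟩
  - det (suc n) (classMatrix cs v α) ∎
  where
  open ReducedChange (step-change st)
  n = dimN cs
  z : Fin (suc size) → ℤ
  z zero    = 1ℤ
  z (suc i) = -1ℤ
  q : Fin (suc size) → Fin (suc n)
  q zero    = zero
  q (suc i) = suc (block i)
  agreeOff : AgreeOff (suc pos) (classMatrix cs v α) (classMatrix cs w α)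
  agreeOff r zero    _       = refl
  agreeOff r (suc k) k≢pos = sym (unchanged (α r) k (k≢pos ∘ cong suc))
  newColumn : ∀ r → classMatrix cs w α r (suc pos)
                    ≡ sumℤ (suc size) (λ i → z i * classMatrix cs v α r (q i))
  newColumn r = begin
    red cs w (α r) pos                                           ≡⟨ changed (α r) ⟩
    1ℤ + - sumℤ size (λ i → red cs v (α r) (block i))           ≡⟨ cong (1ℤ +_) (sumℤ-negate size (red cs v (α r) ∘ block)) ⟨
    1ℤ + sumℤ size (λ i → -1ℤ * red cs v (α r) (block i))       ≡⟨ cong (_+ sumℤ size (λ i → -1ℤ * red cs v (α r) (block i))) (*-identityˡ 1ℤ) ⟨
    1ℤ * 1ℤ + sumℤ size (λ i → -1ℤ * red cs v (α r) (block i)) ∎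

class-step : ∀ {cs} (α : Fin (suc (dimN cs)) → Vtx cs) {v w : Vtx cs} →
  Step cs v w → classOf cs v α ≡ classOf cs w α
class-step {cs} α {v} st =
  sym (trans (cong ∣_∣ (det-step st α)) (∣-i∣≡∣i∣ (det (suc (dimN cs)) (classMatrix cs v α))))

climb : ∀ {c} (R : Fin (suc c) → Fin (suc c) → Set) → (∀ j → R (inject₁ j) (suc j)) → ∀ a → Star R zero a
climb R step zero = ε
climb {suc c} R step (suc j) =
  gmap inject₁ id (climb (λ x y → R (inject₁ x) (inject₁ y)) (step ∘ inject₁) j) ◅◅ (step j ◅ ε)

origin : (cs : List ℕ) → Vtx cs
origin []       = tt
origin (c ∷ cs) = zero , origin cs

reach : ∀ cs (v : Vtx cs) → Star (Step cs) (origin cs) v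
reach []       tt      = ε
reach (c ∷ cs) (a , v) =
  gmap (zero ,_) (there zero) (reach cs v) ◅◅ gmap (_, v) id (climb (λ x y → Step (c ∷ cs) (x , v) (y , v)) (λ j → here j v) a)

class-independent : ∀ cs (α : Fin (suc (dimN cs)) → Vtx cs) (v w : Vtx cs) → classOf cs v α ≡ classOf cs w α
class-independent cs α v w = trans (sym (fromOrigin v)) (fromOrigin w)
  where
  fromOrigin : ∀ u → classOf cs (origin cs) α ≡ classOf cs u α
  fromOrigin u = fold (λ x y → classOf cs x α ≡ classOf cs y α) (λ st e → trans (class-step α st) e) refl (reach cs u)

theorem3 : (cs : List ℕ) (T : VertexTriangulation cs)
           (s : Fin (VertexTriangulation.numSimplices T)) (v w : Vtx cs) →
           classOf cs v (VertexTriangulation.simplex T s)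
             ≡ classOf cs w (VertexTriangulation.simplex T s)
theorem3 cs T s v w = class-independent cs (VertexTriangulation.simplex T s) v w
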